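{- Let $\varphi$ be an LTL formula over $V$ with decomposition $\langle\varphi_1,\dots,\varphi_n\rangle$. Let $\mathcal{G}=\langle g_1,\dots,g_n\rangle$ be guarantee transition systems, $\mathcal{G}_i=\{g_j\mid j\ne i\}$, and let $\mathcal{S}=\langle s_1,\dots,s_n\rangle$ where $s_i$ is a local strategy with respect to $\mathcal{G}_i$. If $(\mathcal{S},\mathcal{G})$ is a solution of certifying synthesis with local strategies for $\varphi$, then $(\mathcal{S}',\mathcal{G})$ is a solution of certifying synthesis with (complete strategies and) local satisfaction for $\varphi$, where $\mathcal{S}'=\langle s'_1,\dots,s'_n\rangle$ and $s'_i$ is an extension of $s_i$ with respect to $\mathcal{G}$.
   Context: An architecture consists of an environment process $env$ with output variables $O_{env}$ and $n\ge 2$ system processes $p_1,\dots,p_n$, a finite set $V$ of variables, and for each $p_i$ an input set $I_i\subseteq V$ and output set $O_i\subseteq V$ with $I_i\cap O_i=\emptyset$ and $O_j\cap O_k=\emptyset$ for $j\ne k$. Let $V_i=I_i\cup O_i$, $V=\bigcup_i V_i$, $inp=\bigcup_i I_i$, $out=\bigcup_i O_i$. Intersections/unions of words are letterwise (a union of a finite and infinite word is truncated to the finite length); $\sigma_{[t]}$ is the length-$t$ prefix, $\sigma_k$ the $k$-th letter. A (Moore) transition system over inputs $I$ and outputs $O$ is $(T,t_0,\tau,o)$ with finite $T$, transition function $\tau:T\times 2^I\to T$ (partial for local strategies), $o:T\to 2^O$; on $\gamma\in(2^I)^\omega$ it visits $t_0t_1\dots$ with $t_{k+1}=\tau(t_k,\gamma_k)$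 and produces the trace $(\gamma_0\cup o(t_0))(\gamma_1\cup o(t_1))\dots$, finite if an undefined transition is reached. A (complete) strategy $s_i$ is such a system over $I_i,O_i$ with total $\tau$; $comp(s_i,\gamma)$ is its trace. Decomposition: $\varphi=\xi_1\wedge\dots\wedge\xi_k$ with atomic propositions in $V$; $\varphi_i$ is the conjunction of the $\xi_j$ whose atomic propositions intersect $O_i$ or are disjoint from $out$. GTS: $O^G_i=O_i\cap inp$; a GTS $g_i$ is a transition system over $I_i$ and $O^G_i$ with total $\tau$. For a set $\mathcal{G}'$ of GTS, $\sigma\in(2^V)^*$ of length $t$ is a valid history w.r.t. $\mathcal{G}'$ if for all $g_j\in\mathcal{G}'$, $1\le k\le t$ and infinite extensions $\hat\sigma$: $\sigma_k\cap O^G_j=comp(g_j,\hat\sigma\cap I_j)_k\cap O^G_j$. Local satisfaction $s_i\models_{\mathcal{G}'}\chi$: $comp(s_i,\gamma)\cup\gamma'\models\chi$ for all $\gamma\in(2^{I_i})^\omega,\gamma'\in(2^{V\setminus V_i})^\omega$ with $comp(s_i,\gamma)_{[t]}\cup\gamma'_{[t]}$ a valid history w.r.t. $\mathcal{G}'$ for all $t$. Simulation $s\preceq_{O^G_i}g_i$: a relation between states of $s$ and $g_i$ containing the initial pair, whose related states have outputs agreeing on $O^G_i$, and such that if $(t,u)$ is related and $s$ has a transition from $t$ on input $\iota$, then the $\iota$-successors are related. Certifying synthesis with local satisfaction: $(\mathcal{S}',\mathcal{G})$ is a solution if for all $i$, $s'_i\preceq_{O^G_i}g_i$ and $s'_i\models_{\mathcal{G}_i}\varphi_i$.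 Local strategy w.r.t. $\mathcal{G}'$: a transition system over $I_i,O_i$ with partial transition function such that $comp(s_i,\gamma)$ is infinite iff there exists $\gamma'\in(2^{V\setminus V_i})^\omega$ with $comp(s_i,\gamma)_{[t]}\cup\gamma'_{[t]}$ a valid history w.r.t. $\mathcal{G}'$ for all $t$. A universal co-Büchi automaton $(Q,q_0,\delta,F)$ accepts a word iff all its runs visit $F$ finitely often. Certifying synthesis with local strategies: $(\mathcal{S},\mathcal{G})$ is a solution if for all $i$, $s_i$ is a local strategy w.r.t. $\mathcal{G}_i$, $s_i\preceq_{O^G_i}g_i$, and for all $\gamma\in(2^{I_i})^\omega,\gamma'\in(2^{V\setminus V_i})^\omega$, every (finite or infinite) run of $\mathcal{A}_i$ on $comp(s_i,\gamma)\cup\gamma'$ visits rejecting states only finitely often, where $\mathcal{A}_i$ is a universal co-Büchi automaton with $\mathcal{L}(\mathcal{A}_i)=\mathcal{L}(\varphi_i)$. Extension: an extension $s'_i$ of a local strategy $s_i$ w.r.t. $\mathcal{G}$ is a complete strategy for $p_i$ with $comp(s'_i,\gamma)=comp(s_i,\gamma)$ whenever $comp(s_i,\gamma)$ is infinite, and $comp(s'_i,\gamma)=comp(g_i,\gamma)\cup\sigma'$ for some $\sigma'\in(2^{O_i\setminus O^G_i})^\omega$ whenever $comp(s_i,\gamma)$ is finite. -}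

module Defs where

open import Data.Nat using (ℕ; zero; suc; _≤_; _<_)
open import Data.Bool using (Bool; true; false; not; _∧_; _∨_)
open import Data.Fin using (Fin)
open import Data.Fin.Subset using (Subset; _∈_; _∉_; _⊆_; _∪_; _∩_; ∁; ⊥; ⋃; ⁅_⁆)
open import Data.Vec using ([]; _∷_)
open import Data.List using (List; []; _∷_; map; allFin; filterᵇ; foldr)
open import Data.Maybe using (Maybe; just; nothing; maybe; _>>=_)
open import Data.Product using (Σ; ∃; _×_; _,_)
open import Data.Unit using (⊤)
open import Relation.Binary.PropositionalEquality using (_≡_; _≢_)
open import Relation.Nullary using (¬_)

-- Letters are subsets of the variable set V = Fin nv; words are ℕ → letters.
-- A finite word of length t is represented by any word together with t
-- (only positions < t matter).

Word : ℕ → Set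
Word nv = ℕ → Subset nv

InW : ∀ {nv} → Subset nv → Word nv → Set
InW S γ = ∀ k → γ k ⊆ S

_∩ʷ_ : ∀ {nv} → Word nv → Subset nv → Word nv
(w ∩ʷ S) k = w k ∩ S

emptyB : ∀ {m} → Subset m → Bool
emptyB [] = true
emptyB (b ∷ bs) = not b ∧ emptyB bs

data LTL (nv : ℕ) : Set where
  ttₗ  : LTL nv
  varₗ : Fin nv → LTL nv
  ¬ₗ_  : LTL nv → LTL nv
  _∧ₗ_ : LTL nv → LTL nv → LTL nv
  Xₗ_  : LTL nv → LTL nv
  _Uₗ_ : LTL nv → LTL nv → LTL nv

atoms : ∀ {nv} → LTL nv → Subset nv
atoms ttₗ = ⊥
atoms (varₗ v) = ⁅ v ⁆
atoms (¬ₗ φ) = atoms φ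
atoms (φ ∧ₗ ψ) = atoms φ ∪ atoms ψ
atoms (Xₗ φ) = atoms φ
atoms (φ Uₗ ψ) = atoms φ ∪ atoms ψ

_,_⊨_ : ∀ {nv} → Word nv → ℕ → LTL nv → Set
w , i ⊨ ttₗ = ⊤
w , i ⊨ varₗ v = v ∈ w i
w , i ⊨ (¬ₗ φ) = ¬ (w , i ⊨ φ)
w , i ⊨ (φ ∧ₗ ψ) = (w , i ⊨ φ) × (w , i ⊨ ψ)
w , i ⊨ (Xₗ φ) = w , suc i ⊨ φ
w , i ⊨ (φ Uₗ ψ) =
  ∃ λ j → i ≤ j × (w , j ⊨ ψ) × (∀ m → i ≤ m → m < j → w , m ⊨ φ)

⋀ : ∀ {nv} → List (LTL nv) → LTL nv
⋀ = foldr _∧ₗ_ ttₗ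

record TS (nv : ℕ) (I O : Subset nv) : Set where
  field
    size : ℕ
    t₀   : Fin size
    τ    : Fin size → Subset nv → Maybe (Fin size)
    o    : Fin size → Subset nv
    o⊆O  : ∀ t → o t ⊆ O

open TS public

Defined : ∀ {A : Set} → Maybe A → Set
Defined {A} m = Σ A λ a → m ≡ just a

Complete : ∀ {nv I O} → TS nv I O → Set
Complete {I = I} s = ∀ t ι → ι ⊆ I → Defined (τ s t ι)

run : ∀ {nv I O} (s : TS nv I O) → Word nv → ℕ → Maybe (Fin (size s))
run s γ zero = just (t₀ s)
run s γ (suc k) = run s γ k >>= λ t → τ s t (γ k)

-- the trace comp(s,γ): letter k is γ_k ∪ o(t_k); it is a letter of the
-- (possibly finite) trace iff run s γ k is defined
comp : ∀ {nv I O} (s : TS nv I O) → Word nv → Word nv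
comp s γ k = γ k ∪ maybe (o s) ⊥ (run s γ k)

Inf : ∀ {nv I O} (s : TS nv I O) → Word nv → Set
Inf s γ = ∀ k → Defined (run s γ k)

HasPrefix : ∀ {nv I O} (s : TS nv I O) → Word nv → ℕ → Set
HasPrefix s γ t = ∀ k → k < t → Defined (run s γ k)

Comb : ∀ {nv I O} (s : TS nv I O) → Word nv → Word nv → Word nv
Comb s γ γ' k = comp s γ k ∪ γ' k

Sim : ∀ {nv I O O'} → Subset nv → TS nv I O → TS nv I O' → Set₁
Sim {I = I} OG s g =
  Σ (Fin (size s) → Fin (size g) → Set) λ R →
    R (t₀ s) (t₀ g)
    × (∀ t u → R t u → o s t ∩ OG ≡ o g u ∩ OG)
    × (∀ t u ι → R t u → ι ⊆ I → ∀ t' → τ s t ι ≡ just t' →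
         Σ (Fin (size g)) λ u' → τ g u ι ≡ just u' × R t' u')

record UCB (nv : ℕ) : Set where
  field
    qsize : ℕ
    q₀    : Fin qsize
    δ     : Fin qsize → Subset nv → Subset qsize
    F     : Subset qsize

open UCB public

IsRun : ∀ {nv} (A : UCB nv) → Word nv → (ℕ → Fin (qsize A)) → Set
IsRun A w r = r zero ≡ q₀ A × (∀ m → r (suc m) ∈ δ A (r m) (w m))

Accepts : ∀ {nv} (A : UCB nv) → Word nv → Set
Accepts A w =
  ∀ r → IsRun A w r → ∃ λ N → ∀ m → N ≤ m → r m ∉ F A

LangEq : ∀ {nv} → UCB nv → LTL nv → Set
LangEq A χ = ∀ w → (Accepts A w → w , zero ⊨ χ) × (w , zero ⊨ χ → Accepts A w)

record Arch : Set where
  field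
    nv    : ℕ
    n     : ℕ
    2≤n   : 2 ≤ n
    I     : Fin n → Subset nv
    O     : Fin n → Subset nv
    IO-disj : ∀ i → I i ∩ O i ≡ ⊥
    O-disj  : ∀ j k → j ≢ k → O j ∩ O k ≡ ⊥
    cover   : ∀ v → ∃ λ i → v ∈ (I i ∪ O i)

module _ (Ar : Arch) where
  open Arch Ar

  inp : Subset nv
  inp = ⋃ (map I (allFin n))

  out : Subset nv
  out = ⋃ (map O (allFin n))

  Vᵢ : Fin n → Subset nv
  Vᵢ i = I i ∪ O i

  Oth : Fin n → Subset nv
  Oth i = ∁ (Vᵢ i)

  OG : Fin n → Subset nv
  OG i = O i ∩ inp

  GTS : Fin n → Set
  GTS i = TS nv (I i) (OG i)

  Strat : Fin n → Set
  Strat i = TS nv (I i) (O i)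

  relevant : Fin n → LTL nv → Bool
  relevant i ξ = not (emptyB (atoms ξ ∩ O i)) ∨ emptyB (atoms ξ ∩ out)

  φᵢ : Fin n → List (LTL nv) → LTL nv
  φᵢ i ξs = ⋀ (filterᵇ (relevant i) ξs)

  module _ (G : (i : Fin n) → GTS i) where

    ValidHist : (Fin n → Set) → Word nv → ℕ → Set
    ValidHist J σ t =
      ∀ j → J j → ∀ k → k < t → ∀ (σ̂ : Word nv) → (∀ m → m < t → σ̂ m ≡ σ m) →
        σ k ∩ OG j ≡ comp (G j) (σ̂ ∩ʷ I j) k ∩ OG j

    Gᵢ : Fin n → Fin n → Set
    Gᵢ i j = j ≢ i

    PrefixesValid : (i : Fin n) → Strat i → Word nv → Word nv → Set
    PrefixesValid i s γ γ' =
      ∀ t → HasPrefix s γ t → ValidHist (Gᵢ i) (Comb s γ γ') t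

    LocSat : (i : Fin n) → Strat i → LTL nv → Set
    LocSat i s χ =
      ∀ γ γ' → InW (I i) γ → InW (Oth i) γ' → PrefixesValid i s γ γ' →
        Comb s γ γ' , zero ⊨ χ

    LocalStrategy : (i : Fin n) → Strat i → Set
    LocalStrategy i s =
      ∀ γ → InW (I i) γ →
        (Inf s γ → ∃ λ γ' → InW (Oth i) γ' × PrefixesValid i s γ γ')
        × ((∃ λ γ' → InW (Oth i) γ' × PrefixesValid i s γ γ') → Inf s γ)

    Extension : (i : Fin n) → Strat i → Strat i → Set
    Extension i s s' =
      Complete s'
      × (∀ γ → InW (I i) γ →
           (Inf s γ → ∀ k → comp s' γ k ≡ comp s γ k)
           × (¬ Inf s γ → ∃ λ σ' → InW (O i ∩ ∁ (OG i)) σ'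
                 × (∀ k → comp s' γ k ≡ comp (G i) γ k ∪ σ' k)))

    SolLocalStrategies : List (LTL nv) → (Fin n → UCB nv) → ((i : Fin n) → Strat i) → Set₁
    SolLocalStrategies ξs As S = ∀ i →
      LocalStrategy i (S i)
      × Sim (OG i) (S i) (G i)
      × (∀ γ γ' → InW (I i) γ → InW (Oth i) γ' →
           Inf (S i) γ → Accepts (As i) (Comb (S i) γ γ'))

    SolLocalSat : List (LTL nv) → ((i : Fin n) → Strat i) → Set₁
    SolLocalSat ξs S' = ∀ i →
      Complete (S' i)
      × Sim (OG i) (S' i) (G i)
      × LocSat i (S' i) (φᵢ i ξs)

{-# OPTIONS --safe #-}
module Submission where

open import Defs
open import Data.Fin using (Fin)
open import Data.List using (List)

open import Data.Bool using () renaming (_≟_ to _≟ᵇ_)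
open import Data.Fin.Subset using (Subset; _∈_; _∉_; _⊆_; _∪_; _∩_; ∁; ⊥; ⋃)
open import Data.Fin.Subset.Properties
  using ( _∈?_; ⊆-antisym; ⊆-trans; ⊥⊆; Empty-unique; x∈p∩q⁺; x∈p∩q⁻; x∈p∪q⁺
        ; x∉p⇒x∈∁p; x∈∁p⇒x∉p; p∩q⊆q; p⊆p∪q; q⊆p∪q
        ; ∉⊥; ∩-zeroˡ; ∩-assoc; ∩-distribˡ-∪; ∩-distribʳ-∪; ∪-identityˡ; ∪-identityʳ)
open import Data.List.Membership.Propositional using () renaming (_∈_ to _∈ₗ_)
open import Data.List.Membership.Propositional.Properties using (∈-allFin; ∈-map⁺)
open import Data.List.Relation.Unary.Any using (here; there)
open import Data.Maybe using (Maybe; just; nothing; maybe; _>>=_)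
open import Data.Nat using (ℕ; zero; suc; _<_; _<?_)
open import Data.Nat.Properties using (n<1+n; m<n⇒m<1+n; n≮n)
open import Data.Product using (Σ; ∃; _×_; _,_; proj₁; proj₂)
open import Data.Sum using (inj₁; inj₂)
open import Data.Vec.Properties using (≡-dec)
open import Relation.Binary.PropositionalEquality using (_≡_; refl; sym; trans; cong; cong₂; subst; module ≡-Reasoning)
open import Relation.Nullary using (¬_; yes; no; contradiction)
open import Relation.Nullary.Decidable using (decidable-stable; ¬¬-excluded-middle)

-- As s ⪯ g, the traces of s' agree with those of g on O^G everywhere, which
-- makes s' ⪯ g; and they agree with those of s on all of inp wherever s is
-- defined.  Validity of a history only reads variables of inp, so a prefix
-- valid for s' is valid for s.  Hence, whenever the premise of local
-- satisfaction holds for s', the run of the local strategy s is infinite,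
-- s' = s on it, and the automaton for φᵢ accepts.

module _ {m : ℕ} where

  AgreeOn : Subset m → Subset m → Subset m → Set
  AgreeOn X A B = A ∩ X ≡ B ∩ X

  ⊆⋃ : ∀ {A : Subset m} {l} → A ∈ₗ l → A ⊆ ⋃ l
  ⊆⋃ (here refl) = p⊆p∪q _
  ⊆⋃ (there A∈l) = ⊆-trans (⊆⋃ A∈l) (q⊆p∪q _ _)

  ∩≡⊥ : ∀ {A X : Subset m} → (∀ {x} → x ∈ A → x ∉ X) → A ∩ X ≡ ⊥
  ∩≡⊥ {A} {X} disj = Empty-unique λ (x , x∈A∩X) →
    let (x∈A , x∈X) = x∈p∩q⁻ A X x∈A∩X in disj x∈A x∈X

  ⊆∁⇒∩≡⊥ : ∀ {A X : Subset m} → A ⊆ ∁ X → A ∩ X ≡ ⊥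
  ⊆∁⇒∩≡⊥ A⊆∁X = ∩≡⊥ λ x∈A → x∈∁p⇒x∉p (A⊆∁X x∈A)

  ⊆⇒∩∁≡⊥ : ∀ {A Z : Subset m} → A ⊆ Z → A ∩ ∁ Z ≡ ⊥
  ⊆⇒∩∁≡⊥ A⊆Z = ∩≡⊥ λ x∈A x∈∁Z → x∈∁p⇒x∉p x∈∁Z (A⊆Z x∈A)

  ⊆-∩≡⊥ : ∀ {A B X : Subset m} → A ⊆ B → B ∩ X ≡ ⊥ → A ∩ X ≡ ⊥
  ⊆-∩≡⊥ {A} {B} {X} A⊆B B∩X≡⊥ = ∩≡⊥ λ x∈A x∈X →
    ∉⊥ (subst (_ ∈_) B∩X≡⊥ (x∈p∩q⁺ (A⊆B x∈A , x∈X)))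

  ⊆⇒∩≡ : ∀ {X Y : Subset m} → X ⊆ Y → Y ∩ X ≡ X
  ⊆⇒∩≡ {X} {Y} X⊆Y = ⊆-antisym (p∩q⊆q Y X) λ x∈X → x∈p∩q⁺ (X⊆Y x∈X , x∈X)

  agreeOn-mono : ∀ {X Y A B : Subset m} → X ⊆ Y → AgreeOn Y A B → AgreeOn X A B
  agreeOn-mono {X} {Y} {A} {B} X⊆Y A≈B = begin
    A ∩ X        ≡⟨ cong (A ∩_) (sym (⊆⇒∩≡ X⊆Y)) ⟩
    A ∩ (Y ∩ X)  ≡⟨ sym (∩-assoc A Y X) ⟩
    (A ∩ Y) ∩ X  ≡⟨ cong (_∩ X) A≈B ⟩
    (B ∩ Y) ∩ X  ≡⟨ ∩-assoc B Y X ⟩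
    B ∩ (Y ∩ X)  ≡⟨ cong (B ∩_) (⊆⇒∩≡ X⊆Y) ⟩
    B ∩ X        ∎
    where open ≡-Reasoning

  agreeOn-∪ : ∀ {X A B C D : Subset m} → AgreeOn X A B → AgreeOn X C D →
              AgreeOn X (A ∪ C) (B ∪ D)
  agreeOn-∪ {X} {A} {B} {C} {D} A≈B C≈D = begin
    (A ∪ C) ∩ X        ≡⟨ ∩-distribʳ-∪ X A C ⟩
    A ∩ X ∪ C ∩ X      ≡⟨ cong₂ _∪_ A≈B C≈D ⟩
    B ∩ X ∪ D ∩ X      ≡⟨ sym (∩-distribʳ-∪ X B D) ⟩
    (B ∪ D) ∩ X        ∎
    where open ≡-Reasoning

  agreeOn-∪-disjointˡ : ∀ {X A C : Subset m} → C ∩ X ≡ ⊥ → AgreeOn X (C ∪ A) A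
  agreeOn-∪-disjointˡ {X} {A} {C} C∩X≡⊥ =
    trans (∩-distribʳ-∪ X C A) (trans (cong (_∪ A ∩ X) C∩X≡⊥) (∪-identityˡ (A ∩ X)))

  agreeOn-∪-disjointʳ : ∀ {X A C : Subset m} → C ∩ X ≡ ⊥ → AgreeOn X (A ∪ C) A
  agreeOn-∪-disjointʳ {X} {A} {C} C∩X≡⊥ =
    trans (∩-distribʳ-∪ X A C) (trans (cong (A ∩ X ∪_) C∩X≡⊥) (∪-identityʳ (A ∩ X)))

  agreeOn-cancelˡ : ∀ {X A B C : Subset m} → C ∩ X ≡ ⊥ →
                    AgreeOn X (C ∪ A) (C ∪ B) → AgreeOn X A B
  agreeOn-cancelˡ C∩X≡⊥ CA≈CB =
    trans (sym (agreeOn-∪-disjointˡ C∩X≡⊥)) (trans CA≈CB (agreeOn-∪-disjointˡ C∩X≡⊥))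

  agreeOn-split : ∀ {Y Z A B : Subset m} → AgreeOn (Z ∩ Y) A B → AgreeOn (∁ Z) A B →
                  AgreeOn Y A B
  agreeOn-split {Y} {Z} {A} {B} inside outside = agreeOn-mono Y⊆ (begin
    A ∩ (Z ∩ Y ∪ ∁ Z)          ≡⟨ ∩-distribˡ-∪ A (Z ∩ Y) (∁ Z) ⟩
    A ∩ (Z ∩ Y) ∪ A ∩ ∁ Z      ≡⟨ cong₂ _∪_ inside outside ⟩
    B ∩ (Z ∩ Y) ∪ B ∩ ∁ Z      ≡⟨ sym (∩-distribˡ-∪ B (Z ∩ Y) (∁ Z)) ⟩
    B ∩ (Z ∩ Y ∪ ∁ Z)          ∎)
    where
    open ≡-Reasoning
    Y⊆ : Y ⊆ Z ∩ Y ∪ ∁ Z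
    Y⊆ {x} x∈Y with x ∈? Z
    ... | yes x∈Z = x∈p∪q⁺ (inj₁ (x∈p∩q⁺ (x∈Z , x∈Y)))
    ... | no  x∉Z = x∈p∪q⁺ (inj₂ (x∉p⇒x∈∁p x∉Z))

  -- Subset equality is decidable, hence stable, so it may be proved by cases
  -- on an undecidable proposition.
  ≡-byCases : ∀ {A B : Subset m} (P : Set) → (P → A ≡ B) → (¬ P → A ≡ B) → A ≡ B
  ≡-byCases {A} {B} P yes⇒ no⇒ =
    decidable-stable (≡-dec _≟ᵇ_ A B) λ A≢B → ¬¬-excluded-middle λ where
      (yes p) → A≢B (yes⇒ p)
      (no ¬p) → A≢B (no⇒ ¬p)

module _ {nv : ℕ} where

  splice : ℕ → Word nv → Word nv → Word nv
  splice t u v k with k <? t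
  ... | yes _ = u k
  ... | no  _ = v k

  splice-< : ∀ {t u v k} → k < t → splice t u v k ≡ u k
  splice-< {t} {k = k} k<t with k <? t
  ... | yes _   = refl
  ... | no  k≮t = contradiction k<t k≮t

  splice-≥ : ∀ {t u v k} → ¬ k < t → splice t u v k ≡ v k
  splice-≥ {t} {k = k} k≮t with k <? t
  ... | yes k<t = contradiction k<t k≮t
  ... | no  _   = refl

  splice-InW : ∀ {S t u v} → InW S u → InW S v → InW S (splice t u v)
  splice-InW {t = t} u∈ v∈ k with k <? t
  ... | yes _ = u∈ k
  ... | no  _ = v∈ k

  splice-agreeOn : ∀ {X t u v} → (∀ k → k < t → AgreeOn X (u k) (v k)) →
                   ∀ k → AgreeOn X (splice t u v k) (v k)
  splice-agreeOn {t = t} u≈v k with k <? t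
  ... | yes k<t = u≈v k k<t
  ... | no  _   = refl

  Accepts-cong : ∀ {A : UCB nv} {w w'} → (∀ k → w k ≡ w' k) → Accepts A w → Accepts A w'
  Accepts-cong {A} w≡w' acc r (r₀ , r-step) =
    acc r (r₀ , λ k → subst (λ a → r (suc k) ∈ δ A (r k) a) (sym (w≡w' k)) (r-step k))

module _ {nv : ℕ} {I O : Subset nv} (s : TS nv I O) where

  run-cong : ∀ {γ δ} k → (∀ m → m < k → γ m ≡ δ m) → run s γ k ≡ run s δ k
  run-cong zero    _   = refl
  run-cong (suc k) γ≡δ =
    cong₂ (λ r ι → r >>= λ t → τ s t ι)
          (run-cong k λ m m<k → γ≡δ m (m<n⇒m<1+n m<k)) (γ≡δ k (n<1+n k))

  run-step : ∀ γ k {t t'} → run s γ k ≡ just t → τ s t (γ k) ≡ just t' →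
             run s γ (suc k) ≡ just t'
  run-step γ k eq eq' = trans (cong (_>>= λ t → τ s t (γ k)) eq) eq'

  Complete⇒Inf : Complete s → ∀ {γ} → InW I γ → Inf s γ
  Complete⇒Inf _          _  zero = t₀ s , refl
  Complete⇒Inf s-complete {γ} γ∈ (suc k) with Complete⇒Inf s-complete γ∈ k
  ... | t , eq with s-complete t (γ k) (γ∈ k)
  ... | t' , eq' = t' , run-step γ k eq eq'

  comp-cong : ∀ {γ δ} → (∀ m → γ m ≡ δ m) → ∀ k → comp s γ k ≡ comp s δ k
  comp-cong γ≡δ k = cong₂ _∪_ (γ≡δ k) (cong (maybe (o s) ⊥) (run-cong k λ m _ → γ≡δ m))

  comp-just : ∀ γ k {t} → run s γ k ≡ just t → comp s γ k ≡ γ k ∪ o s t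
  comp-just γ k eq = cong (λ r → γ k ∪ maybe (o s) ⊥ r) eq

  output-⊆ : (r : Maybe (Fin (size s))) → maybe (o s) ⊥ r ⊆ O
  output-⊆ (just t) = o⊆O s t
  output-⊆ nothing  = ⊥⊆

module _ {nv : ℕ} {I O O' X : Subset nv} {s : TS nv I O} {g : TS nv I O'}
         (s⪯g : Sim X s g) where

  run-sim : ∀ {γ} → InW I γ → ∀ k {t} → run s γ k ≡ just t →
            Σ (Fin (size g)) λ u → run g γ k ≡ just u × proj₁ s⪯g t u
  run-sim _ zero refl = t₀ g , refl , proj₁ (proj₂ s⪯g)
  run-sim {γ} γ∈ (suc k) eq with run s γ k in eqₖ
  ... | just t with run-sim γ∈ k eqₖ
  ... | u , eqᵤ , Rtu with proj₂ (proj₂ (proj₂ s⪯g)) t u (γ k) Rtu (γ∈ k) _ eq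
  ... | u' , eq' , Rt'u' = u' , run-step g γ k eqᵤ eq' , Rt'u'

  sim⇒agreeOn : ∀ {γ} → InW I γ → ∀ {k} → Defined (run s γ k) →
                AgreeOn X (comp s γ k) (comp g γ k)
  sim⇒agreeOn {γ} γ∈ {k} (t , eq) with run-sim γ∈ k eq
  ... | u , eq' , Rtu =
    trans (cong (_∩ X) (comp-just s γ k eq))
          (trans (agreeOn-∪ refl (proj₁ (proj₂ (proj₂ s⪯g)) t u Rtu))
                 (cong (_∩ X) (sym (comp-just g γ k eq'))))

module _ {nv : ℕ} {I O O' : Subset nv} (s : TS nv I O) (g : TS nv I O') where

  CoReachable : Fin (size s) → Fin (size g) → Set
  CoReachable t u = ∃ λ γ → ∃ λ k → InW I γ × run s γ k ≡ just t × run g γ k ≡ just u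

  agreeOn⇒Sim : ∀ {X} → Complete g → I ∩ X ≡ ⊥ →
                (∀ γ → InW I γ → ∀ k → AgreeOn X (comp s γ k) (comp g γ k)) → Sim X s g
  agreeOn⇒Sim {X} g-complete I∩X≡⊥ agree = CoReachable , initial , outputs , step
    where
    initial : CoReachable (t₀ s) (t₀ g)
    initial = (λ _ → ⊥) , zero , (λ _ → ⊥⊆) , refl , refl

    outputs : ∀ t u → CoReachable t u → AgreeOn X (o s t) (o g u)
    outputs t u (γ , k , γ∈ , s-run , g-run) = agreeOn-cancelˡ (⊆-∩≡⊥ (γ∈ k) I∩X≡⊥) (begin
      (γ k ∪ o s t) ∩ X  ≡⟨ cong (_∩ X) (comp-just s γ k s-run) ⟨
      comp s γ k ∩ X     ≡⟨ agree γ γ∈ k ⟩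
      comp g γ k ∩ X     ≡⟨ cong (_∩ X) (comp-just g γ k g-run) ⟩
      (γ k ∪ o g u) ∩ X  ∎)
      where open ≡-Reasoning

    step : ∀ t u ι → CoReachable t u → ι ⊆ I → ∀ t' → τ s t ι ≡ just t' →
           Σ (Fin (size g)) λ u' → τ g u ι ≡ just u' × CoReachable t' u'
    step t u ι (γ , k , γ∈ , s-run , g-run) ι⊆I t' s-step with g-complete u ι ι⊆I
    ... | u' , g-step = u' , g-step , γ' , suc k , splice-InW {t = k} γ∈ (λ _ → ι⊆I)
                    , extend s s-run s-step , extend g g-run g-step
      where
      γ' : Word nv
      γ' = splice k γ (λ _ → ι)
      extend : ∀ {O''} (h : TS nv I O'') {a b} → run h γ k ≡ just a → τ h a ι ≡ just b →
               run h γ' (suc k) ≡ just b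
      extend h {a} eq eqτ = run-step h γ' k
        (trans (run-cong h k λ m m<k → splice-< m<k) eq)
        (trans (cong (τ h a) (splice-≥ (n≮n k))) eqτ)

module _ (Ar : Arch) (G : (i : Fin (Arch.n Ar)) → GTS Ar i) where
  open Arch Ar

  I⊆inp : ∀ j → I j ⊆ inp Ar
  I⊆inp j = ⊆⋃ (∈-map⁺ I (∈-allFin j))

  OG⊆inp : ∀ j → OG Ar j ⊆ inp Ar
  OG⊆inp j = p∩q⊆q (O j) (inp Ar)

  I∩OG≡⊥ : ∀ i → I i ∩ OG Ar i ≡ ⊥
  I∩OG≡⊥ i = begin
    I i ∩ (O i ∩ inp Ar)  ≡⟨ ∩-assoc (I i) (O i) (inp Ar) ⟨
    (I i ∩ O i) ∩ inp Ar  ≡⟨ cong (_∩ inp Ar) (IO-disj i) ⟩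
    ⊥ ∩ inp Ar            ≡⟨ ∩-zeroˡ (inp Ar) ⟩
    ⊥                     ∎
    where open ≡-Reasoning

  module _ {i : Fin n} {s s' : Strat Ar i}
           (s⪯g : Sim (OG Ar i) s (G i)) (ext : Extension Ar G i s s') where

    extension-agreeOn-OG : ∀ {γ} → InW (I i) γ → ∀ k →
                           AgreeOn (OG Ar i) (comp s' γ k) (comp (G i) γ k)
    extension-agreeOn-OG {γ} γ∈ k = ≡-byCases (Inf s γ) infinite finite
      where
      infinite : Inf s γ → AgreeOn (OG Ar i) (comp s' γ k) (comp (G i) γ k)
      infinite inf = trans (cong (_∩ OG Ar i) (proj₁ (proj₂ ext γ γ∈) inf k))
                           (sim⇒agreeOn s⪯g γ∈ (inf k))
      finite : ¬ Inf s γ → AgreeOn (OG Ar i) (comp s' γ k) (comp (G i) γ k)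
      finite fin with proj₂ (proj₂ ext γ γ∈) fin
      ... | σ' , σ'∈ , s'≡g∪σ' =
        trans (cong (_∩ OG Ar i) (s'≡g∪σ' k))
              (agreeOn-∪-disjointʳ (⊆∁⇒∩≡⊥ (⊆-trans (σ'∈ k) (p∩q⊆q (O i) _))))

    -- Outside O i both traces consist of the input letter only, and inside
    -- O i the variables of inp are exactly those of OG.
    extension-agreeOn-inp : ∀ {γ} → InW (I i) γ → ∀ {k} → Defined (run s γ k) →
                            AgreeOn (inp Ar) (comp s' γ k) (comp s γ k)
    extension-agreeOn-inp {γ} γ∈ {k} s-def = agreeOn-split
      (trans (extension-agreeOn-OG γ∈ k) (sym (sim⇒agreeOn s⪯g γ∈ s-def)))
      (agreeOn-∪ {A = γ k} refl (trans (⊆⇒∩∁≡⊥ (output-⊆ s' (run s' γ k)))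
                                       (sym (⊆⇒∩∁≡⊥ (output-⊆ s (run s γ k))))))

    extension-prefixesValid : ∀ {γ γ'} → InW (I i) γ →
                              PrefixesValid Ar G i s' γ γ' → PrefixesValid Ar G i s γ γ'
    extension-prefixesValid {γ} {γ'} γ∈ valid' t s-def j j≢i k k<t σ̂ σ̂≡ = begin
      Comb s γ γ' k ∩ OG Ar j           ≡⟨ agreeOn-mono (OG⊆inp j) (comb-agree k k<t) ⟨
      Comb s' γ γ' k ∩ OG Ar j          ≡⟨ valid' t s'-def j j≢i k k<t σ̂' (λ _ → splice-<) ⟩
      comp (G j) (σ̂' ∩ʷ I j) k ∩ OG Ar j ≡⟨ cong (_∩ OG Ar j) (comp-cong (G j) σ̂'≈σ̂ k) ⟩
      comp (G j) (σ̂ ∩ʷ I j) k ∩ OG Ar j  ∎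
      where
      open ≡-Reasoning
      s'-def : HasPrefix s' γ t
      s'-def m _ = Complete⇒Inf s' (proj₁ ext) γ∈ m
      comb-agree : ∀ m → m < t → AgreeOn (inp Ar) (Comb s' γ γ' m) (Comb s γ γ' m)
      comb-agree m m<t = agreeOn-∪ (extension-agreeOn-inp γ∈ (s-def m m<t)) refl
      σ̂' : Word nv
      σ̂' = splice t (Comb s' γ γ') σ̂
      σ̂'≈σ̂ : ∀ m → (σ̂' ∩ʷ I j) m ≡ (σ̂ ∩ʷ I j) m
      σ̂'≈σ̂ = splice-agreeOn λ m m<t →
        trans (agreeOn-mono (I⊆inp j) (comb-agree m m<t)) (cong (_∩ I j) (sym (σ̂≡ m m<t)))

    extension-Sim : Complete (G i) → Sim (OG Ar i) s' (G i)
    extension-Sim g-complete =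
      agreeOn⇒Sim s' (G i) g-complete (I∩OG≡⊥ i) λ γ γ∈ → extension-agreeOn-OG γ∈

    extension-LocSat : ∀ {A : UCB nv} {χ} → LocalStrategy Ar G i s →
                       (∀ γ γ' → InW (I i) γ → InW (Oth Ar i) γ' → Inf s γ →
                          Accepts A (Comb s γ γ')) →
                       LangEq A χ → LocSat Ar G i s' χ
    extension-LocSat {A} local accepts A≡χ γ γ' γ∈ γ'∈ valid' =
      proj₁ (A≡χ (Comb s' γ γ')) (Accepts-cong {A = A} s≡s' (accepts γ γ' γ∈ γ'∈ inf))
      where
      inf : Inf s γ
      inf = proj₂ (local γ γ∈) (γ' , γ'∈ , extension-prefixesValid γ∈ valid')
      s≡s' : ∀ k → Comb s γ γ' k ≡ Comb s' γ γ' k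
      s≡s' k = cong (_∪ γ' k) (sym (proj₁ (proj₂ ext γ γ∈) inf k))

lemma8 : (Ar : Arch) → (φ : LTL (Arch.nv Ar)) → (ξs : List (LTL (Arch.nv Ar))) →
    φ ≡ ⋀ ξs →
    (G : (i : Fin (Arch.n Ar)) → GTS Ar i) → (∀ i → Complete (G i)) →
    (S : (i : Fin (Arch.n Ar)) → Strat Ar i) →
    (∀ i → LocalStrategy Ar G i (S i)) →
    (As : Fin (Arch.n Ar) → UCB (Arch.nv Ar)) → (∀ i → LangEq (As i) (φᵢ Ar i ξs)) →
    SolLocalStrategies Ar G ξs As S →
    (S' : (i : Fin (Arch.n Ar)) → Strat Ar i) → (∀ i → Extension Ar G i (S i) (S' i)) →
    SolLocalSat Ar G ξs S'
lemma8 Ar _ ξs _ G G-complete _ local As As≡φ solution S' ext i =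
  let (_ , s⪯g , accepts) = solution i in
  proj₁ (ext i) ,
  extension-Sim Ar G s⪯g (ext i) (G-complete i) ,
  extension-LocSat Ar G s⪯g (ext i) {As i} {φᵢ Ar i ξs} (local i) accepts (As≡φ i)
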